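{- For every $n\in\mathbb{N}$, we have $s(2n)\ge b(n)$, where $s(m)$ is the minimum number such that every temporal clique with $m$ vertices admits a spanner with at most $s(m)$ edges, and $b(m)$ is the minimum number such that every temporal bi-clique with $m$ vertices on each side admits a bi-spanner with at most $b(m)$ edges.
   Context: A temporal graph is $(V,E,\lambda)$ with $\lambda\colon E\to\mathbb{N}$. A path $v_1\dots v_k$ is temporal if $\lambda(\{v_i,v_{i+1}\})\le\lambda(\{v_{i+1},v_{i+2}\})$ for all $i\in[k-2]$. A temporal clique has a complete underlying graph; a spanner is an edge set $S$ such that every vertex reaches every other vertex by a temporal path within $S$. A temporal bi-clique $(A,B,\lambda)$ has the complete bipartite graph with disjoint parts $A,B$ as underlying graph; a bi-spanner is an edge set $S$ such that every $a\in A$ reaches every $b\in B$ by a temporal path within $S$. -}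

module Defs where

open import Data.Nat using (ℕ; _≤_)
open import Data.Fin using (Fin)
open import Data.Product using (Σ; _×_; _,_)
open import Data.Sum using (_⊎_; inj₁; inj₂)
open import Data.Unit using (⊤)
open import Data.Empty using (⊥)
open import Data.List using (List; []; _∷_; _++_; length)
open import Data.List.Membership.Propositional using (_∈_)
open import Data.List.Relation.Unary.Unique.Propositional using (Unique)
open import Relation.Binary.PropositionalEquality using (_≡_; _≢_)

Temporal : {V : Set} → (V → V → ℕ) → (V → V → Set) → List V → Set
Temporal L E []               = ⊤
Temporal L E (x ∷ [])         = ⊤
Temporal L E (x ∷ y ∷ [])     = E x y
Temporal L E (x ∷ y ∷ z ∷ vs) = E x y × L x y ≤ L y z × Temporal L E (y ∷ z ∷ vs)

Reaches : {V : Set} → (V → V → ℕ) → (V → V → Set) → V → V → Set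
Reaches L E u v =
  Σ (List _) λ mid → Unique (u ∷ mid ++ v ∷ []) × Temporal L E (u ∷ mid ++ v ∷ [])

-- A labelling of the complete graph K_m is a symmetric λ : Fin m → Fin m → ℕ
-- (the diagonal values are irrelevant: paths have distinct vertices).
-- An edge set S is a list of pairs; (x , y) ∈ S represents the edge {x , y}.
-- (A list of length ≤ k exists iff an edge set of size ≤ k exists.)

CliqueEdge : {m : ℕ} → List (Fin m × Fin m) → Fin m → Fin m → Set
CliqueEdge S x y = ((x , y) ∈ S) ⊎ ((y , x) ∈ S)

IsSpanner : {m : ℕ} → (Fin m → Fin m → ℕ) → List (Fin m × Fin m) → Set
IsSpanner {m} λ' S = (u v : Fin m) → u ≢ v → Reaches λ' (CliqueEdge S) u v

SpannerBound : ℕ → ℕ → Set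
SpannerBound m k =
  (λ' : Fin m → Fin m → ℕ) → (∀ i j → λ' i j ≡ λ' j i) →
  Σ (List (Fin m × Fin m)) λ S → length S ≤ k × IsSpanner λ' S

-- Temporal bi-cliques with parts A = Fin n (inj₁) and B = Fin n (inj₂).
-- λ a b is the label of the edge {a , b}; (a , b) ∈ S represents edge {a , b}.

BiEdge : {n : ℕ} → List (Fin n × Fin n) → (Fin n ⊎ Fin n) → (Fin n ⊎ Fin n) → Set
BiEdge S (inj₁ a) (inj₂ b) = (a , b) ∈ S
BiEdge S (inj₂ b) (inj₁ a) = (a , b) ∈ S
BiEdge S (inj₁ _) (inj₁ _) = ⊥
BiEdge S (inj₂ _) (inj₂ _) = ⊥

BiLabel : {n : ℕ} → (Fin n → Fin n → ℕ) → (Fin n ⊎ Fin n) → (Fin n ⊎ Fin n) → ℕ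
BiLabel λ' (inj₁ a) (inj₂ b) = λ' a b
BiLabel λ' (inj₂ b) (inj₁ a) = λ' a b
BiLabel λ' (inj₁ _) (inj₁ _) = 0   -- not an edge; never used
BiLabel λ' (inj₂ _) (inj₂ _) = 0   -- not an edge; never used

IsBiSpanner : {n : ℕ} → (Fin n → Fin n → ℕ) → List (Fin n × Fin n) → Set
IsBiSpanner {n} λ' S =
  (a b : Fin n) → Reaches (BiLabel λ') (BiEdge S) (inj₁ a) (inj₂ b)

BiSpannerBound : ℕ → ℕ → Set
BiSpannerBound n k =
  (λ' : Fin n → Fin n → ℕ) →
  Σ (List (Fin n × Fin n)) λ S → length S ≤ k × IsBiSpanner λ' S

IsMinimum : (ℕ → Set) → ℕ → Set
IsMinimum P s = P s × ((k : ℕ) → P k → s ≤ k)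

-- Encode a bi-clique labelling λ on A ∪ B as a clique labelling of K_{2n}: edges inside A get a
-- label larger than every label of λ, edges inside B get 0, and a cross edge {a, b} gets
-- λ(a, b) + 1. A temporal path from a ∈ A to b ∈ B starts with a label ≥ 1 and ends with a
-- label below that of the A-edges; by monotonicity all its labels lie in this window, so it
-- uses cross edges only and is a temporal path of the bi-clique. Hence the cross edges of any
-- spanner of K_{2n} form a bi-spanner, and b(n) ≤ s(2n).
module Submission where

open import Defs
open import Data.Nat using (ℕ; zero; suc; _≤_; _<_; _+_; _*_; _⊔_; z≤n; s≤s; s≤s⁻¹)
open import Data.Nat.Properties
  using (≤-refl; ≤-reflexive; ≤-trans; ≤-<-trans; <-irrefl; m≤m⊔n; m≤n⊔m; +-identityʳ)
open import Data.Fin using (Fin; zero; suc; splitAt; join)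
open import Data.Fin.Properties using (splitAt-join; join-splitAt)
open import Data.Product using (Σ; ∃; _×_; _,_; proj₁; proj₂)
import Data.Product as Product
open import Data.Sum using (_⊎_; inj₁; inj₂)
open import Data.Empty using (⊥-elim)
open import Data.Unit using (tt)
open import Data.Maybe using (Maybe; just; nothing)
open import Data.List using (List; []; _∷_; _++_; length; map; mapMaybe)
open import Data.List.Properties using (length-map; length-mapMaybe; map-++)
open import Data.List.Membership.Propositional using (_∈_)
open import Data.List.Membership.Propositional.Properties using (∈-map⁺)
open import Data.List.Relation.Unary.Any using (here; there)
open import Data.List.Relation.Unary.Unique.Propositional using (Unique)
import Data.List.Relation.Unary.Unique.Propositional.Properties as Unique
open import Relation.Binary.PropositionalEquality

-- On Fin m this is definitionally CliqueEdge.
Adjacent : {V : Set} → List (V × V) → V → V → Set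
Adjacent S x y = (x , y) ∈ S ⊎ (y , x) ∈ S

Adjacent-map : {V W : Set} (f : V → W) {S : List (V × V)} {x y : V} →
  Adjacent S x y → Adjacent (map (Product.map f f) S) (f x) (f y)
Adjacent-map f (inj₁ xy∈S) = inj₁ (∈-map⁺ (Product.map f f) xy∈S)
Adjacent-map f (inj₂ yx∈S) = inj₂ (∈-map⁺ (Product.map f f) yx∈S)

mapMaybe-∈ : {A B : Set} (f : A → Maybe B) {x : A} {y : B} (xs : List A) →
  x ∈ xs → f x ≡ just y → y ∈ mapMaybe f xs
mapMaybe-∈ f (x ∷ xs) (here refl) fx≡y with f x
mapMaybe-∈ f (x ∷ xs) (here refl) refl | just _ = here refl
mapMaybe-∈ f (x ∷ xs) (there x∈xs) fx≡y with f x
... | just _  = there (mapMaybe-∈ f xs x∈xs fx≡y)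
... | nothing = mapMaybe-∈ f xs x∈xs fx≡y

Fin-bounded : {n : ℕ} (f : Fin n → ℕ) → ∃ λ c → ∀ i → f i ≤ c
Fin-bounded {zero}  f = 0 , λ ()
Fin-bounded {suc n} f with Fin-bounded (λ i → f (suc i))
... | c , f≤c = f zero ⊔ c , λ where
  zero    → m≤m⊔n (f zero) c
  (suc i) → ≤-trans (f≤c i) (m≤n⊔m (f zero) c)

splitAt-injective : (m : ℕ) {n : ℕ} {i j : Fin (m + n)} → splitAt m i ≡ splitAt m j → i ≡ j
splitAt-injective m {n} {i} {j} eq =
  trans (sym (join-splitAt m n i)) (trans (cong (join m n) eq) (join-splitAt m n j))

module _ {V : Set} {L : V → V → ℕ} where

  Temporal-map : {W : Set} (f : W → V) {E : W → W → Set} {E′ : V → V → Set} →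
    (∀ {x y} → E x y → E′ (f x) (f y)) →
    ∀ xs → Temporal (λ x y → L (f x) (f y)) E xs → Temporal L E′ (map f xs)
  Temporal-map f edge []               t               = tt
  Temporal-map f edge (x ∷ [])         t               = tt
  Temporal-map f edge (x ∷ y ∷ [])     exy             = edge exy
  Temporal-map f edge (x ∷ y ∷ z ∷ vs) (exy , ≤yz , t) =
    edge exy , ≤yz , Temporal-map f edge (y ∷ z ∷ vs) t

  Reaches-map : {W : Set} (f : W → V) → (∀ {x y} → f x ≡ f y → x ≡ y) →
    {E : W → W → Set} {E′ : V → V → Set} → (∀ {x y} → E x y → E′ (f x) (f y)) →
    ∀ {u v} → Reaches (λ x y → L (f x) (f y)) E u v → Reaches L E′ (f u) (f v)
  Reaches-map f f-inj edge {u} {v} (mid , unique , temporal) =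
    map f mid , subst Unique path-map (Unique.map⁺ f-inj unique)
              , subst (Temporal L _) path-map (Temporal-map f edge (u ∷ mid ++ v ∷ []) temporal)
    where
    path-map : map f (u ∷ mid ++ v ∷ []) ≡ f u ∷ map f mid ++ f v ∷ []
    path-map = cong (f u ∷_) (map-++ f mid (v ∷ []))

  lastLabel : V → V → List V → ℕ
  lastLabel x y []       = L x y
  lastLabel x y (z ∷ zs) = lastLabel y z zs

  firstLabel≤lastLabel : {E : V → V → Set} → ∀ x y zs →
    Temporal L E (x ∷ y ∷ zs) → L x y ≤ lastLabel x y zs
  firstLabel≤lastLabel x y []       _            = ≤-refl
  firstLabel≤lastLabel x y (z ∷ zs) (_ , ≤yz , t) = ≤-trans ≤yz (firstLabel≤lastLabel y z zs t)

  lastLabel-into : ∀ {v hi} → (∀ w → L w v < hi) → ∀ x y zs → lastLabel x y (zs ++ v ∷ []) < hi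
  lastLabel-into into-v x y []       = into-v y
  lastLabel-into into-v x y (z ∷ zs) = lastLabel-into into-v y z zs

  -- A temporal path with all labels in [lo, hi) only sees the edges inside this window, so it
  -- stays temporal for any (L′, E′) keeping those edges and the order of their labels.
  module Window {E : V → V → Set} {L′ : V → V → ℕ} {E′ : V → V → Set} (lo hi : ℕ)
    (edge : ∀ {p q} → lo ≤ L p q → L p q < hi → E p q → E′ p q)
    (label : ∀ {p q r s} → lo ≤ L p q → L r s < hi → L p q ≤ L r s → L′ p q ≤ L′ r s)
    where

    Temporal-window : ∀ x y zs → Temporal L E (x ∷ y ∷ zs) →
      lo ≤ L x y → lastLabel x y zs < hi → Temporal L′ E′ (x ∷ y ∷ zs)
    Temporal-window x y [] exy lo≤ <hi = edge lo≤ <hi exy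
    Temporal-window x y (z ∷ zs) (exy , ≤yz , t) lo≤ <hi =
      edge lo≤ xy<hi exy , label lo≤ yz<hi ≤yz , Temporal-window y z zs t (≤-trans lo≤ ≤yz) <hi
      where
      yz<hi : L y z < hi
      yz<hi = ≤-<-trans (firstLabel≤lastLabel y z zs t) <hi
      xy<hi : L x y < hi
      xy<hi = ≤-<-trans ≤yz yz<hi

    Reaches-window : ∀ {u v} → (∀ w → lo ≤ L u w) → (∀ w → L w v < hi) →
      Reaches L E u v → Reaches L′ E′ u v
    Reaches-window {u} {v} from-u into-v ([] , unique , t) =
      [] , unique , Temporal-window u v [] t (from-u v) (into-v u)
    Reaches-window {u} {v} from-u into-v (y ∷ mid , unique , t) =
      y ∷ mid , unique , Temporal-window u y (mid ++ v ∷ []) t (from-u y)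
                                         (lastLabel-into into-v u y mid)

module Encoding (n : ℕ) (λ′ : Fin n → Fin n → ℕ) where

  Part : Set
  Part = Fin n ⊎ Fin n

  ceiling : ℕ
  ceiling = proj₁ (Fin-bounded (λ a → proj₁ (Fin-bounded (λ′ a))))

  λ′≤ceiling : ∀ a b → λ′ a b ≤ ceiling
  λ′≤ceiling a b = ≤-trans (proj₂ (Fin-bounded (λ′ a)) b)
                           (proj₂ (Fin-bounded (λ a → proj₁ (Fin-bounded (λ′ a)))) a)

  top : ℕ
  top = suc (suc ceiling)

  cliqueLabel : Part → Part → ℕ
  cliqueLabel (inj₁ _) (inj₁ _) = top
  cliqueLabel (inj₁ a) (inj₂ b) = suc (λ′ a b)
  cliqueLabel (inj₂ b) (inj₁ a) = suc (λ′ a b)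
  cliqueLabel (inj₂ _) (inj₂ _) = 0

  cliqueLabel-sym : ∀ p q → cliqueLabel p q ≡ cliqueLabel q p
  cliqueLabel-sym (inj₁ _) (inj₁ _) = refl
  cliqueLabel-sym (inj₁ _) (inj₂ _) = refl
  cliqueLabel-sym (inj₂ _) (inj₁ _) = refl
  cliqueLabel-sym (inj₂ _) (inj₂ _) = refl

  leaving-A : ∀ a w → 1 ≤ cliqueLabel (inj₁ a) w
  leaving-A a (inj₁ _) = s≤s z≤n
  leaving-A a (inj₂ _) = s≤s z≤n

  entering-B : ∀ w b → cliqueLabel w (inj₂ b) < top
  entering-B (inj₁ a) b = s≤s (s≤s (λ′≤ceiling a b))
  entering-B (inj₂ _) b = s≤s z≤n

  window-cross : ∀ p q → 1 ≤ cliqueLabel p q → cliqueLabel p q < top →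
    cliqueLabel p q ≡ suc (BiLabel λ′ p q)
  window-cross (inj₁ _) (inj₁ _) _ <top = ⊥-elim (<-irrefl refl <top)
  window-cross (inj₁ _) (inj₂ _) _ _    = refl
  window-cross (inj₂ _) (inj₁ _) _ _    = refl
  window-cross (inj₂ _) (inj₂ _) () _

  crossing : Part × Part → Maybe (Fin n × Fin n)
  crossing (inj₁ a , inj₂ b) = just (a , b)
  crossing (inj₂ b , inj₁ a) = just (a , b)
  crossing (inj₁ _ , inj₁ _) = nothing
  crossing (inj₂ _ , inj₂ _) = nothing

  window-edge : (S : List (Part × Part)) → ∀ {p q} → 1 ≤ cliqueLabel p q → cliqueLabel p q < top →
    Adjacent S p q → BiEdge (mapMaybe crossing S) p q
  window-edge S {inj₁ _} {inj₁ _} _ <top _ = ⊥-elim (<-irrefl refl <top)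
  window-edge S {inj₂ _} {inj₂ _} () _ _
  window-edge S {inj₁ _} {inj₂ _} _ _ (inj₁ ab∈S) = mapMaybe-∈ crossing S ab∈S refl
  window-edge S {inj₁ _} {inj₂ _} _ _ (inj₂ ba∈S) = mapMaybe-∈ crossing S ba∈S refl
  window-edge S {inj₂ _} {inj₁ _} _ _ (inj₁ ba∈S) = mapMaybe-∈ crossing S ba∈S refl
  window-edge S {inj₂ _} {inj₁ _} _ _ (inj₂ ab∈S) = mapMaybe-∈ crossing S ab∈S refl

  window-label : ∀ {p q r s} → 1 ≤ cliqueLabel p q → cliqueLabel r s < top →
    cliqueLabel p q ≤ cliqueLabel r s → BiLabel λ′ p q ≤ BiLabel λ′ r s
  window-label {p} {q} {r} {s} 1≤pq rs<top pq≤rs = s≤s⁻¹ (subst₂ _≤_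
    (window-cross p q 1≤pq (≤-<-trans pq≤rs rs<top))
    (window-cross r s (≤-trans 1≤pq pq≤rs) rs<top) pq≤rs)

  cross-edges : (S : List (Part × Part)) → ∀ a b →
    Reaches cliqueLabel (Adjacent S) (inj₁ a) (inj₂ b) →
    Reaches (BiLabel λ′) (BiEdge (mapMaybe crossing S)) (inj₁ a) (inj₂ b)
  cross-edges S a b = Reaches-window (leaving-A a) (λ w → entering-B w b)
    where open Window {L = cliqueLabel} 1 top (window-edge S) window-label

  labelling : Fin (n + n) → Fin (n + n) → ℕ
  labelling i j = cliqueLabel (splitAt n i) (splitAt n j)

  biSpanner : List (Fin (n + n) × Fin (n + n)) → List (Fin n × Fin n)
  biSpanner S = mapMaybe crossing (map (Product.map (splitAt n) (splitAt n)) S)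

  length-biSpanner : ∀ S → length (biSpanner S) ≤ length S
  length-biSpanner S = ≤-trans (length-mapMaybe crossing (map _ S)) (≤-reflexive (length-map _ S))

  spanner⇒biSpanner : ∀ S → IsSpanner labelling S → IsBiSpanner λ′ (biSpanner S)
  spanner⇒biSpanner S spanner a b =
    cross-edges _ a b (subst₂ (Reaches cliqueLabel _) (splitAt-join n n (inj₁ a)) (splitAt-join n n (inj₂ b))
      (Reaches-map (splitAt n) (splitAt-injective n) (Adjacent-map (splitAt n))
        (spanner (join n n (inj₁ a)) (join n n (inj₂ b)) A≢B)))
    where
    A≢B : join n n (inj₁ a) ≢ join n n (inj₂ b)
    A≢B eq with subst₂ _≡_ (splitAt-join n n (inj₁ a)) (splitAt-join n n (inj₂ b)) (cong (splitAt n) eq)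
    ... | ()

  biSpanner-bound : ∀ k → SpannerBound (n + n) k →
    Σ (List (Fin n × Fin n)) λ S → length S ≤ k × IsBiSpanner λ′ S
  biSpanner-bound k bound with bound labelling (λ i j → cliqueLabel-sym (splitAt n i) (splitAt n j))
  ... | S , |S|≤k , spanner = biSpanner S , ≤-trans (length-biSpanner S) |S|≤k , spanner⇒biSpanner S spanner

spannerBound⇒biSpannerBound : ∀ n k → SpannerBound (n + n) k → BiSpannerBound n k
spannerBound⇒biSpannerBound n k bound λ′ = Encoding.biSpanner-bound n λ′ k bound

theorem8 : (n s b : ℕ) →
    IsMinimum (SpannerBound (2 * n)) s →
    IsMinimum (BiSpannerBound n) b →
    b ≤ s
theorem8 n s b (s-bound , _) (_ , b-minimal) =
  b-minimal s (spannerBound⇒biSpannerBound n s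
    (subst (λ m → SpannerBound m s) (cong (n +_) (+-identityʳ n)) s-bound))
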